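{- Let $k\ge 2$, $n,N\ge1$ and $b\ge0$ be integers. Let $f:[n]^{k-1}\times[N]\to\{0,1\}$ be a graph function and let $A=\mathrm{Base}(f)$. Then $$N^1_k(f)\ \ge\ \min\{\,N^{h}_{k-1,b}(A)-\log N-k+1,\ b\,\}.$$
   Context: NOF model: $m$ players receive $(x_1,\ldots,x_m)$; player $i$ sees all $x_j$ with $j\ne i$ but not $x_i$. The players write bits in turns on a shared blackboard; each bit depends on what the writer sees and on the blackboard so far. Nondeterministic NOF complexity of a Boolean function $g$: in addition, all players see a proof string supplied by an all-powerful prover. A protocol is correct if (i) on every input with $g=1$ some proof string makes the protocol output $1$, and (ii) on every input with $g=0$ every proof string leads to output $0$. The cost is the maximum total number of proof bits plus communicated bits. $N^1_m(g)$ is the minimum cost of a correct protocol. A function $f:[n]^{k-1}\times[N]\to\{0,1\}$ is a graph function if for every $(x_1,\ldots,x_{k-1})$ there is a unique $y\in[N]$ with $f(x_1,\ldots,x_{k-1},y)=1$. $\mathrm{Base}(f):[n]^{k-1}\to[N]$ maps $(x_1,\ldots,x_{k-1})$ to that $y$. Nondeterministic communication with help for $A:[n]^m\to[N]$: on input $(x_1,\ldots,x_m)$ a helper who sees the whole input first writes a help string of at most $b$ bits, which may depend arbitrarily on the input. Then the $m$ players also receive a proof string from a prover and communicate in the NOF model. They output either a value or "don't know". Correctness requires two things. First, the output is never a wrong value. Second, for every input some proof string yields the correct value $A(x_1,\ldots,x_m)$. The cost is the maximum of the help length plus the subsequent proof and communication length. $N^{h}_{m,b}(A)$ is the minimum cost.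 -}

module Defs where

open import Data.Nat using (ℕ; zero; suc; _+_; _≤_)
open import Data.Fin using (Fin; inject₁; fromℕ)
open import Data.Bool using (Bool; true; false; if_then_else_)
open import Data.Maybe using (Maybe; just; nothing)
open import Data.Vec using (Vec)
open import Data.List using (List; length)
open import Data.Product using (Σ; _×_; _,_; proj₁; ∃)
open import Relation.Binary.PropositionalEquality using (_≡_)
open import Relation.Nullary using (¬_)

-- Generic Number-On-Forehead (NOF) setting.
-- m players, input type I, and  Agree i x x'  meaning: x and x' coincide
-- on every coordinate except (possibly) player i's own coordinate,
-- i.e. player i cannot distinguish x from x'.

Setting : ℕ → Set → Set₁
Setting m I = Fin m → I → I → Set

Sees : {m : ℕ} {I : Set} → Setting m I → Fin m → (I → Bool) → Set
Sees Agree i g = ∀ x x' → Agree i x x' → g x ≡ g x'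

-- At each node the blackboard so far is the path from the root; the node
-- names the speaking player and the bit it writes (a function of what that
-- player sees).
data Proto {m : ℕ} {I : Set} (Agree : Setting m I) (Out : Set) : ℕ → Set where
  leaf : ∀ {c} → Out → Proto Agree Out c
  node : ∀ {c} (i : Fin m) (g : I → Bool) → Sees Agree i g →
         (onFalse onTrue : Proto Agree Out c) → Proto Agree Out (suc c)

run : {m : ℕ} {I : Set} {Agree : Setting m I} {Out : Set} {c : ℕ} →
      Proto Agree Out c → I → Out
run (leaf o) x = o
run (node i g _ l r) x = if g x then run r x else run l x

-- Nondeterministic NOF protocol for a Boolean function g of cost ≤ C:
-- a proof string of p bits seen by all players, then a protocol of at most
-- c communicated bits (which may depend on the proof), with p + c ≤ C.

record NondetProtocol {m : ℕ} {I : Set} (Agree : Setting m I)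
                      (g : I → Bool) (C : ℕ) : Set where
  field
    proofLen : ℕ
    commLen  : ℕ
    cost     : proofLen + commLen ≤ C
    P        : Vec Bool proofLen → Proto Agree Bool commLen
    complete : ∀ x → g x ≡ true → ∃ λ π → run (P π) x ≡ true
    sound    : ∀ x → g x ≡ false → ∀ π → run (P π) x ≡ false

-- The helper (seeing the whole input) writes a
-- help string h of at most b bits; then a proof string (whose length may
-- depend on h) is given and the players communicate (protocol may depend on
-- h and the proof).  Output is  just v  (a value) or  nothing  ("don't know").

record HelpProtocol {m : ℕ} {I : Set} (Agree : Setting m I) {Out : Set}
                    (A : I → Out) (b : ℕ) (C : ℕ) : Set where
  field
    help      : I → List Bool
    helpShort : ∀ x → length (help x) ≤ b
    proofLen  : List Bool → ℕ
    commLen   : List Bool → ℕ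
    P         : (h : List Bool) → Vec Bool (proofLen h) →
                Proto Agree (Maybe Out) (commLen h)
    cost      : ∀ x → length (help x) + proofLen (help x) + commLen (help x) ≤ C
    noWrong   : ∀ x π v → run (P (help x) π) x ≡ just v → v ≡ A x
    complete  : ∀ x → ∃ λ π → run (P (help x) π) x ≡ just (A x)

-- Inputs of A : [n]^m → [N]; m players, player j holds xs j on its forehead.
InA : ℕ → ℕ → Set
InA m n = Fin m → Fin n

AgreeA : (m n : ℕ) → Setting m (InA m n)
AgreeA m n i xs xs' = ∀ j → ¬ (j ≡ i) → xs j ≡ xs' j

-- Inputs of f : [n]^m × [N] → {0,1}; m+1 players: player (inject₁ j) holds
-- xs j, the last player (fromℕ m) holds y.
InF : ℕ → ℕ → ℕ → Set
InF m n N = (Fin m → Fin n) × Fin N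

AgreeF : (m n N : ℕ) → Setting (suc m) (InF m n N)
AgreeF m n N i (xs , y) (xs' , y') =
  (∀ j → ¬ (inject₁ j ≡ i) → xs j ≡ xs' j) × (¬ (fromℕ m ≡ i) → y ≡ y')

IsGraphFunction : {m n N : ℕ} → ((Fin m → Fin n) → Fin N → Bool) → Set
IsGraphFunction {N = N} f =
  ∀ xs → Σ (Fin N) λ y → f xs y ≡ true × (∀ y' → f xs y' ≡ true → y' ≡ y)

Base : {m n N : ℕ} (f : (Fin m → Fin n) → Fin N → Bool) →
       IsGraphFunction f → (Fin m → Fin n) → Fin N
Base f isG xs = proj₁ (isG xs)

-- Fix a proof string π accepting (x , A x) and the blackboard β of that accepting run.  The
-- helper writes π and β, at most C < b bits, and the prover guesses y.  Once y is on the
-- board, player j of A sees what player j of f sees, so each of them can check its own bits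
-- of β against the input (x , y); the bits of the y-player do not depend on y and were
-- computed honestly by the helper.  So β is an accepting run on (x , y), and soundness of
-- the protocol for f gives f x y = 1, that is y = A x.  The last bit of β is never written:
-- its speaker instead checks that its next move reaches an accepting leaf.  This saves the
-- one bit needed to spell y out in ⌊log₂ N⌋ + 1 bits.

module Submission where

open import Defs
open import Data.Bool using (Bool; true; false; not; _∧_; if_then_else_)
open import Data.Bool.Properties using (∧-conicalˡ; ∧-conicalʳ; if-eta; if-float; not-injective)
open import Data.Fin using (Fin; zero; suc; toℕ; fromℕ; fromℕ<; inject₁; inject≤; combine; _≟_)
open import Data.Fin.Properties using (toℕ-injective; toℕ-fromℕ<; toℕ-inject≤; toℕ<n; combine-surjective)
open import Data.List using (List; []; _∷_; length; _++_)
open import Data.List.Properties using (length-++)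
open import Data.Maybe as Maybe using (Maybe; just; nothing; maybe)
open import Data.Maybe.Properties using (just-injective)
open import Data.Nat using (ℕ; zero; suc; pred; _+_; _∸_; _^_; _≤_; _<_; z≤n; s≤s; _≤?_; _<?_)
open import Data.Nat.Logarithm using (⌊log₂_⌋; ⌊log₂⌋-mono-≤; ⌊log₂[2^n]⌋≡n)
open import Data.Nat.Properties
  using (≤-trans; ≤-reflexive; <⇒≤; ≰⇒>; <-irrefl; +-suc; +-assoc; pred[n]≤n;
         +-monoˡ-≤; +-monoʳ-≤; module ≤-Reasoning)
open import Data.Product as Product using (∃; _×_; _,_; proj₁; proj₂; uncurry)
open import Data.Sum using (_⊎_; inj₁; inj₂)
open import Data.Vec using (Vec; []; _∷_; toList; allFin)
open import Data.Vec.Membership.Propositional using (_∈_)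
open import Data.Vec.Membership.Propositional.Properties using (∈-allFin⁺)
open import Data.Vec.Properties using (length-toList)
open import Data.Vec.Relation.Unary.Any using (here; there)
open import Function using (_∘_; case_of_)
open import Relation.Binary.PropositionalEquality
  using (_≡_; refl; sym; trans; cong; cong₂; subst; module ≡-Reasoning)
open import Relation.Nullary using (yes; no; does; contradiction)
open import Relation.Nullary.Decidable using (dec-true)

true-reflected : ∀ {a b} → (a ≡ false → b ≡ false) → b ≡ true → a ≡ true
true-reflected {true}  _     _     = refl
true-reflected {false} a⇒¬b b≡true = contradiction (trans (sym b≡true) (a⇒¬b refl)) λ ()

module Transcripts {m : ℕ} {I : Set} (Agree : Setting (suc m) I) where

  isAcceptLeaf : ∀ {c} → Proto Agree Bool c → Bool
  isAcceptLeaf (leaf o)         = o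
  isAcceptLeaf (node _ _ _ _ _) = false

  isAcceptLeaf⇒run : ∀ {c} (t : Proto Agree Bool c) z → isAcceptLeaf t ≡ true → run t z ≡ true
  isAcceptLeaf⇒run (leaf o) z acc = acc

  vouch : Fin (suc m) → Fin (suc m) → Bool → Bool
  vouch i j p = if does (j ≟ i) then p else true

  vouch-self : ∀ j p → vouch j j p ≡ p
  vouch-self j p = cong (if_then p else true) (dec-true (j ≟ j) refl)

  vouch-true : ∀ i j {p} → p ≡ true → vouch i j p ≡ true
  vouch-true i j refl = if-eta (does (j ≟ i))

  vouch-cong : ∀ i j {p q} → (j ≡ i → p ≡ q) → vouch i j p ≡ vouch i j q
  vouch-cong i j p≡q with j ≟ i
  ... | yes j≡i = p≡q j≡i
  ... | no _    = refl

  -- The claimed blackboard omits its final bit, which is checked by its speaker alone.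
  consistent : ∀ {c} → Fin (suc m) → Proto Agree Bool c → List Bool → I → Bool
  consistent i (leaf o)         _            z = o
  consistent i (node j g _ l r) []           z = vouch i j (isAcceptLeaf (if g z then r else l))
  consistent i (node j g _ l r) (true ∷ bs)  z = vouch i j (g z) ∧ consistent i r bs z
  consistent i (node j g _ l r) (false ∷ bs) z = vouch i j (not (g z)) ∧ consistent i l bs z

  mutual
    transcript : ∀ {c} → Proto Agree Bool c → I → List Bool
    transcript (leaf _)         z = []
    transcript (node _ g _ l r) z = if g z then transcriptVia true r z else transcriptVia false l z

    transcriptVia : ∀ {c} → Bool → Proto Agree Bool c → I → List Bool
    transcriptVia b (leaf _)             z = []
    transcriptVia b t@(node _ _ _ _ _) z = b ∷ transcript t z

  mutual
    length-transcript : ∀ {c} (t : Proto Agree Bool c) z → length (transcript t z) ≤ pred c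
    length-transcript (leaf _)         z = z≤n
    length-transcript (node _ g _ l r) z with g z
    ... | true  = length-transcriptVia true r z
    ... | false = length-transcriptVia false l z

    length-transcriptVia : ∀ {c} b (t : Proto Agree Bool c) z → length (transcriptVia b t z) ≤ c
    length-transcriptVia b (leaf _)             z = z≤n
    length-transcriptVia b t@(node _ _ _ _ _) z = s≤s (length-transcript t z)

  consistent-respects : ∀ {c} i (t : Proto Agree Bool c) bs {z z'} → Agree i z z' →
                        consistent i t bs z ≡ consistent i t bs z'
  consistent-respects i (leaf o)         bs           a = refl
  consistent-respects i (node j g s l r) []           a =
    vouch-cong i j λ { refl → cong (λ b → isAcceptLeaf (if b then r else l)) (s _ _ a) }
  consistent-respects i (node j g s l r) (true ∷ bs)  a =
    cong₂ _∧_ (vouch-cong i j λ { refl → s _ _ a }) (consistent-respects i r bs a)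
  consistent-respects i (node j g s l r) (false ∷ bs) a =
    cong₂ _∧_ (vouch-cong i j λ { refl → cong not (s _ _ a) }) (consistent-respects i l bs a)

  consistent-transcript : ∀ {c} i (t : Proto Agree Bool c) z → run t z ≡ true →
                          consistent i t (transcript t z) z ≡ true
  consistent-transcript i (leaf o) z acc = acc
  consistent-transcript i (node j g s l r) z acc with g z in gz
  consistent-transcript i (node j g s l (leaf o)) z acc | true =
    vouch-true i j (trans (cong (λ b → isAcceptLeaf (if b then leaf o else l)) gz) acc)
  consistent-transcript i (node j g s l r@(node _ _ _ _ _)) z acc | true =
    cong₂ _∧_ (vouch-true i j gz) (consistent-transcript i r z acc)
  consistent-transcript i (node j g s (leaf o) r) z acc | false =
    vouch-true i j (trans (cong (λ b → isAcceptLeaf (if b then r else leaf o)) gz) acc)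
  consistent-transcript i (node j g s l@(node _ _ _ _ _) r) z acc | false =
    cong₂ _∧_ (vouch-true i j (cong not gz)) (consistent-transcript i l z acc)

  run-consistent : ∀ {c} (t : Proto Agree Bool c) bs z → (∀ i → consistent i t bs z ≡ true) →
                   run t z ≡ true
  run-consistent (leaf o)         bs           z ok = ok zero
  run-consistent (node j g s l r) []           z ok =
    trans (sym (if-float (λ t → run t z) (g z)))
          (isAcceptLeaf⇒run (if g z then r else l) z (trans (sym (vouch-self j _)) (ok j)))
  run-consistent (node j g s l r) (true ∷ bs)  z ok
    rewrite trans (sym (vouch-self j (g z))) (∧-conicalˡ _ _ (ok j)) =
      run-consistent r bs z (λ i → ∧-conicalʳ _ _ (ok i))
  run-consistent (node j g s l r) (false ∷ bs) z ok
    rewrite not-injective {g z} {false} (trans (sym (vouch-self j _)) (∧-conicalˡ _ _ (ok j))) =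
      run-consistent l bs z (λ i → ∧-conicalʳ _ _ (ok i))

module Unanimity {m : ℕ} {I Out : Set} {Agree : Setting m I}
                 (check : Fin m → I → Bool) (check-sees : ∀ i → Sees Agree i (check i)) where

  unanimously : ∀ {k} → Vec (Fin m) k → Out → Proto Agree (Maybe Out) k
  unanimously []       o = leaf (just o)
  unanimously (i ∷ is) o = node i (check i) (check-sees i) (leaf nothing) (unanimously is o)

  run-unanimously : ∀ {k} (is : Vec (Fin m) k) o x → (∀ i → check i x ≡ true) →
                    run (unanimously is o) x ≡ just o
  run-unanimously []       o x pass = refl
  run-unanimously (i ∷ is) o x pass rewrite pass i = run-unanimously is o x pass

  run-unanimously-just : ∀ {k} (is : Vec (Fin m) k) o x {v} → run (unanimously is o) x ≡ just v →
                         o ≡ v × (∀ {i} → i ∈ is → check i x ≡ true)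
  run-unanimously-just []       o x out = just-injective out , λ ()
  run-unanimously-just (i ∷ is) o x out with check i x in pass-i
  ... | true  = let o≡v , pass = run-unanimously-just is o x out in
                o≡v , λ { (here refl) → pass-i ; (there i∈is) → pass i∈is }
  ... | false = case out of λ ()

fromBits : ∀ {w} → Vec Bool w → Fin (2 ^ w)
fromBits         []      = zero
fromBits {suc w} (b ∷ v) = combine {2} {2 ^ w} (if b then suc zero else zero) (fromBits v)

fromBits-surjective : ∀ {w} (i : Fin (2 ^ w)) → ∃ λ (v : Vec Bool w) → fromBits v ≡ i
fromBits-surjective {zero}  zero = [] , refl
fromBits-surjective {suc w} i with combine-surjective {2} {2 ^ w} i
... | zero , k , refl =
  let v , v↦k = fromBits-surjective k in false ∷ v , cong (combine {2} zero) v↦k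
... | suc zero , k , refl =
  let v , v↦k = fromBits-surjective k in true ∷ v , cong (combine {2} (suc zero)) v↦k

clamp : ∀ {M N} → Fin M → Fin (suc N)
clamp {N = N} i with toℕ i <? suc N
... | yes i<N = fromℕ< i<N
... | no _    = zero

clamp-inject≤ : ∀ {M N} (y : Fin (suc N)) .(N<M : suc N ≤ M) → clamp (inject≤ y N<M) ≡ y
clamp-inject≤ {N = N} y N<M with toℕ (inject≤ y N<M) <? suc N
... | yes y<N = toℕ-injective (trans (toℕ-fromℕ< y<N) (toℕ-inject≤ y N<M))
... | no  y≮N = contradiction (subst (_< suc N) (sym (toℕ-inject≤ y N<M)) (toℕ<n y)) y≮N

decode : ∀ {w N} → Vec Bool w → Fin (suc N)
decode {w} = clamp ∘ fromBits {w}

decode-surjective : ∀ {w N} → suc N ≤ 2 ^ w → (y : Fin (suc N)) → ∃ λ v → decode {w} v ≡ y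
decode-surjective N<2^w y =
  let v , v↦y = fromBits-surjective (inject≤ y N<2^w)
  in v , trans (cong clamp v↦y) (clamp-inject≤ y N<2^w)

n<2^[1+⌊log₂n⌋] : ∀ n → n < 2 ^ suc ⌊log₂ n ⌋
n<2^[1+⌊log₂n⌋] n with 2 ^ suc ⌊log₂ n ⌋ ≤? n
... | no  2^[1+l]≰n = ≰⇒> 2^[1+l]≰n
... | yes 2^[1+l]≤n =
  contradiction (subst (_≤ ⌊log₂ n ⌋) (⌊log₂[2^n]⌋≡n (suc ⌊log₂ n ⌋)) (⌊log₂⌋-mono-≤ 2^[1+l]≤n))
                (<-irrefl refl)

splitVec : ∀ {A : Set} p → List A → Maybe (Vec A p × List A)
splitVec zero    xs       = just ([] , xs)
splitVec (suc p) []       = nothing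
splitVec (suc p) (x ∷ xs) = Maybe.map (Product.map₁ (x ∷_)) (splitVec p xs)

splitVec-toList-++ : ∀ {A : Set} {p} (v : Vec A p) xs → splitVec p (toList v ++ xs) ≡ just (v , xs)
splitVec-toList-++ []      xs = refl
splitVec-toList-++ (x ∷ v) xs rewrite splitVec-toList-++ v xs = refl

inject₁-fromℕ-elim : ∀ {m} {P : Fin (suc m) → Set} → (∀ j → P (inject₁ j)) → P (fromℕ m) → ∀ i → P i
inject₁-fromℕ-elim {zero}      below last zero    = last
inject₁-fromℕ-elim {suc m}     below last zero    = below zero
inject₁-fromℕ-elim {suc m} {P} below last (suc i) = inject₁-fromℕ-elim {m} {P ∘ suc} (below ∘ suc) last i

inject₁-agree : ∀ {m n N j x x'} (y : Fin N) → AgreeA m n j x x' →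
                AgreeF m n N (inject₁ j) (x , y) (x' , y)
inject₁-agree y agree = (λ j' j'≢j → agree j' (j'≢j ∘ cong inject₁)) , λ _ → refl

fromℕ-agree : ∀ {m n N} x (y y' : Fin N) → AgreeF m n N (fromℕ m) (x , y) (x , y')
fromℕ-agree x y y' = (λ _ _ → refl) , λ fromℕ≢fromℕ → contradiction refl fromℕ≢fromℕ

module HelpFromNondeterministic {m n N : ℕ} (f : (Fin m → Fin n) → Fin (suc N) → Bool)
         (isG : IsGraphFunction f) {C : ℕ} (Π : NondetProtocol (AgreeF m n (suc N)) (uncurry f) C) where

  open NondetProtocol Π
  open Transcripts (AgreeF m n (suc N))

  A : (Fin m → Fin n) → Fin (suc N)
  A = Base f isG

  L : ℕ
  L = ⌊log₂ suc N ⌋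

  f-Base : ∀ x → f x (A x) ≡ true
  f-Base x = proj₁ (proj₂ (isG x))

  Base-unique : ∀ x y → f x y ≡ true → y ≡ A x
  Base-unique x y = proj₂ (proj₂ (isG x)) y

  rejects : ∀ π z → uncurry f z ≡ false → run (P π) z ≡ false
  rejects π z fz = sound z fz π

  guessBits : ℕ → ℕ
  guessBits zero    = 0
  guessBits (suc _) = suc L

  pred+guessBits≤ : ∀ c → pred c + guessBits c ≤ c + L
  pred+guessBits≤ zero    = z≤n
  pred+guessBits≤ (suc c) = ≤-reflexive (+-suc c L)

  -- Without communication, accepting (x , A x) means accepting every input, so y is forced.
  guess-exists : ∀ {c} (t : Proto (AgreeF m n (suc N)) Bool c) →
                 (∀ z → uncurry f z ≡ false → run t z ≡ false) →
                 ∀ x → run t (x , A x) ≡ true → ∃ λ (v : Vec Bool (guessBits c)) → decode v ≡ A x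
  guess-exists {zero}  (leaf o) t-rejects x acc =
    [] , Base-unique x (decode {0} []) (true-reflected (t-rejects (x , decode [])) acc)
  guess-exists {suc c} t        t-rejects x acc =
    decode-surjective (<⇒≤ (n<2^[1+⌊log₂n⌋] (suc N))) (A x)

  certificate : (Fin m → Fin n) → Vec Bool proofLen
  certificate x = proj₁ (complete (x , A x) (f-Base x))

  certified : ∀ x → run (P (certificate x)) (x , A x) ≡ true
  certified x = proj₂ (complete (x , A x) (f-Base x))

  honestTranscript : (Fin m → Fin n) → List Bool
  honestTranscript x = transcript (P (certificate x)) (x , A x)

  help : (Fin m → Fin n) → List Bool
  help x = toList (certificate x) ++ honestTranscript x

  length-help : ∀ x → length (help x) ≤ proofLen + pred commLen
  length-help x = begin
    length (toList (certificate x) ++ honestTranscript x)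
      ≡⟨ length-++ (toList (certificate x)) ⟩
    length (toList (certificate x)) + length (honestTranscript x)
      ≡⟨ cong (_+ length (honestTranscript x)) (length-toList (certificate x)) ⟩
    proofLen + length (honestTranscript x)
      ≤⟨ +-monoʳ-≤ proofLen (length-transcript (P (certificate x)) (x , A x)) ⟩
    proofLen + pred commLen
      ∎
    where open ≤-Reasoning

  module _ (t : Proto (AgreeF m n (suc N)) Bool commLen) (ts : List Bool) (y : Fin (suc N)) where
    open Unanimity {Out = Fin (suc N)} (λ j x → consistent (inject₁ j) t ts (x , y))
                   (λ j x x' agree → consistent-respects (inject₁ j) t ts (inject₁-agree y agree))
      public

  verifier : Proto (AgreeF m n (suc N)) Bool commLen → List Bool → Fin (suc N) →
             Proto (AgreeA m n) (Maybe (Fin (suc N))) m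
  verifier t ts y = unanimously t ts y (allFin m) y

  afterHelp : List Bool → Vec Bool (guessBits commLen) → Proto (AgreeA m n) (Maybe (Fin (suc N))) m
  afterHelp h π = maybe (λ (π' , ts) → verifier (P π') ts (decode π)) (leaf nothing) (splitVec proofLen h)

  afterHelp-help : ∀ x π →
                   afterHelp (help x) π ≡ verifier (P (certificate x)) (honestTranscript x) (decode π)
  afterHelp-help x π rewrite splitVec-toList-++ (certificate x) (honestTranscript x) = refl

  afterHelp-complete : ∀ x → ∃ λ π → run (afterHelp (help x) π) x ≡ just (A x)
  afterHelp-complete x =
    let t = P (certificate x) ; ts = honestTranscript x
        π , π↦Ax = guess-exists t (rejects (certificate x)) x (certified x)
    in π , (begin
      run (afterHelp (help x) π) x      ≡⟨ cong (λ q → run q x) (afterHelp-help x π) ⟩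
      run (verifier t ts (decode π)) x  ≡⟨ cong (λ y → run (verifier t ts y) x) π↦Ax ⟩
      run (verifier t ts (A x)) x       ≡⟨ run-unanimously t ts (A x) (allFin m) (A x) x
                                             (λ j → consistent-transcript (inject₁ j) t (x , A x) (certified x)) ⟩
      just (A x)                        ∎)
    where open ≡-Reasoning

  afterHelp-sound : ∀ x π v → run (afterHelp (help x) π) x ≡ just v → v ≡ A x
  afterHelp-sound x π v out =
    let t = P (certificate x) ; ts = honestTranscript x ; y = decode π
        y≡v , checked = run-unanimously-just t ts y (allFin m) y x
                          (trans (cong (λ q → run q x) (sym (afterHelp-help x π))) out)
        everyoneAgrees : ∀ i → consistent i t ts (x , y) ≡ true
        -- the y-player's bits do not depend on y, and on (x , A x) they are honest
        everyoneAgrees = inject₁-fromℕ-elim (λ j → checked (∈-allFin⁺ j))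
          (trans (consistent-respects (fromℕ m) t ts (fromℕ-agree x y (A x)))
                 (consistent-transcript (fromℕ m) t (x , A x) (certified x)))
        f-xy = true-reflected (rejects (certificate x) (x , y)) (run-consistent t ts (x , y) everyoneAgrees)
    in trans (sym y≡v) (Base-unique x y f-xy)

  helpProtocol : ∀ {b} → C < b → HelpProtocol (AgreeA m n) A b (C + L + m)
  helpProtocol C<b = record
    { help      = help
    ; helpShort = λ x → ≤-trans (length-help x)
                          (≤-trans (+-monoʳ-≤ proofLen pred[n]≤n) (≤-trans cost (<⇒≤ C<b)))
    ; proofLen  = λ _ → guessBits commLen
    ; commLen   = λ _ → m
    ; P         = afterHelp
    ; cost      = λ x → +-monoˡ-≤ m (total x)
    ; noWrong   = afterHelp-sound
    ; complete  = afterHelp-complete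
    }
    where
    total : ∀ x → length (help x) + guessBits commLen ≤ C + L
    total x = begin
      length (help x) + guessBits commLen            ≤⟨ +-monoˡ-≤ _ (length-help x) ⟩
      proofLen + pred commLen + guessBits commLen    ≡⟨ +-assoc proofLen _ _ ⟩
      proofLen + (pred commLen + guessBits commLen)  ≤⟨ +-monoʳ-≤ proofLen (pred+guessBits≤ commLen) ⟩
      proofLen + (commLen + L)                       ≡⟨ sym (+-assoc proofLen commLen L) ⟩
      proofLen + commLen + L                         ≤⟨ +-monoˡ-≤ L cost ⟩
      C + L                                          ∎
      where open ≤-Reasoning

theorem6 : (k n N b : ℕ) → 2 ≤ k → 1 ≤ n → 1 ≤ N →
    (f : (Fin (k ∸ 1) → Fin n) → Fin N → Bool) → (isG : IsGraphFunction f) →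
    (C : ℕ) → NondetProtocol (AgreeF (k ∸ 1) n N) (uncurry f) C →
    b ≤ C ⊎ HelpProtocol (AgreeA (k ∸ 1) n) (Base f isG) b (C + ⌊log₂ N ⌋ + (k ∸ 1))
theorem6 k n (suc N) b _ _ _ f isG C Π with b ≤? C
... | yes b≤C = inj₁ b≤C
... | no  b≰C = inj₂ (HelpFromNondeterministic.helpProtocol f isG Π (≰⇒> b≰C))
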